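{- Let $G=(V,E)$ be a graph, $k\ge2$ an integer, and $S$ the set of cutting planes $k$-colouring inequalities of $G$. Let $u_1,\dots,u_\ell$ be fixed vertices of $G$. If for every choice of colours $(c_1,\dots,c_\ell)\in[k]^\ell$ there is a cutting planes refutation of length at most $L$ of $S\cup\{x_{u_1,c_1}=1,\dots,x_{u_\ell,c_\ell}=1\}$, then there is a cutting planes refutation of $S$ of length $k^{O(\ell)}\cdot L$.
   Context: The cutting planes $k$-colouring inequalities of $G$ over $\{0,1\}$-valued variables $x_{v,j}$ ($v\in V$, $j\in[k]$) are: $\sum_{j=1}^k x_{v,j}\ge1$ for $v\in V$; $x_{v,j}+x_{v,j'}\le1$ for $v\in V$, $j\ne j'\in[k]$; $x_{u,j}+x_{v,j}\le1$ for $(u,v)\in E$, $j\in[k]$. Cutting planes works with integer linear inequalities; $\sum a_ix_i\le\gamma$ abbreviates $\sum(-a_i)x_i\ge-\gamma$ and $x=1$ abbreviates $x\le1$ and $x\ge1$. A derivation from a set $S$ is a sequence of inequalities, each a variable axiom $x\ge0$ or $-x\ge-1$, an element of $S$, a sum of two earlier inequalities, a nonnegative integer multiple of an earlier one, or obtained by division (from $\sum a_ix_i\ge\gamma$ with a positive integer $c$ dividing all $a_i$, derive $\sum(a_i/c)x_i\ge\lceil\gamma/c\rceil$). A refutation derives $0\ge1$; length is the number of lines. -}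

module Defs where

open import Data.Nat as ℕ using (ℕ; suc)
open import Data.Integer as ℤ using (ℤ; +_; -_; _+_; _*_; _-_; _≤_; _<_)
open import Data.Fin as Fin using (Fin)
open import Data.Product using (_×_; _,_; ∃; ∃-syntax; Σ-syntax)
open import Data.Sum using (_⊎_)
open import Data.Bool using (if_then_else_; _∧_)
open import Data.List using (List; []; _∷_; length)
open import Data.List.Membership.Propositional using (_∈_)
open import Data.List.Relation.Unary.Any using (Any)
open import Relation.Nullary using (does)
open import Relation.Binary.PropositionalEquality using (_≡_)

-- Variables x_{v,j} with v ∈ V = Fin n and j ∈ [k] = Fin k.
-- A linear inequality  Σ_{v,j} coeff v j · x_{v,j} ≥ const.
record Ineq (n k : ℕ) : Set where
  constructor mkIneq
  field
    coeff : Fin n → Fin k → ℤ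
    const : ℤ
open Ineq public

_≐_ : ∀ {n k} → Ineq n k → Ineq n k → Set
I ≐ J = (∀ v j → coeff I v j ≡ coeff J v j) × (const I ≡ const J)

unit : ∀ {n k} → Fin n → Fin k → Fin n → Fin k → ℤ
unit v j w j' = if does (w Fin.≟ v) ∧ does (j' Fin.≟ j) then + 1 else + 0

row : ∀ {n k} → Fin n → Fin n → Fin k → ℤ
row v w j' = if does (w Fin.≟ v) then + 1 else + 0

addI : ∀ {n k} → Ineq n k → Ineq n k → Ineq n k
addI I J = mkIneq (λ v j → coeff I v j + coeff J v j) (const I + const J)

scaleI : ∀ {n k} → ℕ → Ineq n k → Ineq n k
scaleI c I = mkIneq (λ v j → + c * coeff I v j) (+ c * const I)

negI : ∀ {n k} → (Fin n → Fin k → ℤ) → (Fin n → Fin k → ℤ)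
negI a v j = - a v j

leI : ∀ {n k} → (Fin n → Fin k → ℤ) → ℤ → Ineq n k
leI a γ = mkIneq (negI a) (- γ)

geI : ∀ {n k} → (Fin n → Fin k → ℤ) → ℤ → Ineq n k
geI a γ = mkIneq a γ

falsum : ∀ {n k} → Ineq n k
falsum = mkIneq (λ _ _ → + 0) (+ 1)

IneqSet : ℕ → ℕ → Set₁
IneqSet n k = Ineq n k → Set

_∪_ : ∀ {n k} → IneqSet n k → IneqSet n k → IneqSet n k
(S ∪ T) I = S I ⊎ T I

ColouringIneqs : (n k : ℕ) → List (Fin n × Fin n) → IneqSet n k
ColouringIneqs n k E I =
    (∃[ v ] I ≐ geI (row v) (+ 1))
  ⊎ (∃[ v ] ∃[ j ] ∃[ j' ] (j ≡ j' → ⊥') × I ≐ leI (λ w i → unit v j w i + unit v j' w i) (+ 1))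
  ⊎ (∃[ u ] ∃[ v ] ∃[ j ] ((u , v) ∈ E) × I ≐ leI (λ w i → unit u j w i + unit v j w i) (+ 1))
  where open import Data.Empty renaming (⊥ to ⊥')

-- The inequalities x_{u_i,c_i} = 1, i.e. x_{u_i,c_i} ≤ 1 and x_{u_i,c_i} ≥ 1.
FixColours : ∀ {n k ℓ} → (Fin ℓ → Fin n) → (Fin ℓ → Fin k) → IneqSet n k
FixColours {n} {k} {ℓ} u c I =
  ∃[ i ] (I ≐ leI (unit (u i) (c i)) (+ 1) ⊎ I ≐ geI (unit (u i) (c i)) (+ 1))

data Step {n k : ℕ} (S : IneqSet n k) (prev : List (Ineq n k)) (I : Ineq n k) : Set where
  ax-nonneg : ∀ v j → I ≐ geI (unit v j) (+ 0) → Step S prev I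
  ax-le1    : ∀ v j → I ≐ leI (unit v j) (+ 1) → Step S prev I
  hyp       : S I → Step S prev I
  sum       : ∀ J K → J ∈ prev → K ∈ prev → I ≐ addI J K → Step S prev I
  mult      : ∀ J (c : ℕ) → J ∈ prev → I ≐ scaleI c J → Step S prev I
  -- division by a positive integer c dividing all coefficients; the new
  -- constant is ⌈γ/c⌉, i.e. the least δ with c·δ ≥ γ.
  divide    : ∀ J (c : ℕ) → J ∈ prev → 1 ℕ.≤ c →
              (∀ v j → coeff J v j ≡ + c * coeff I v j) →
              const J ≤ + c * const I →
              + c * const I < const J + + c →
              Step S prev I

-- A derivation, stored newest line first: each line is justified by the lines
-- after it in the list (i.e. the earlier lines of the derivation).
data Derivation {n k : ℕ} (S : IneqSet n k) : List (Ineq n k) → Set where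
  []  : Derivation S []
  _∷_ : ∀ {I ls} → Step S ls I → Derivation S ls → Derivation S (I ∷ ls)

RefutableWithin : ∀ {n k} → IneqSet n k → ℕ → Set
RefutableWithin {n} {k} S L =
  Σ[ ls ∈ List (Ineq n k) ] Derivation S ls × Any (_≐ falsum) ls × length ls ℕ.≤ L

{-# OPTIONS --safe #-}
module Submission where

-- Induction on ℓ, fixing the colour of one vertex v at a time. Deduction lemma: a refutation of
-- S ∪ {A = a} turns into a derivation of A ≤ a − 1 from S by replacing every line I with
-- I − M·(A − a) for a suitable M ≥ 0; sums and multiples carry over directly, and before a
-- division by c one adds (c − 1)·M copies of −A ≥ −a so that the line stays divisible. With
-- A = x_{v,j} this costs at most four lines per line and yields x_{v,j} ≤ 0 for every j, and
-- adding these k inequalities to Σ_j x_{v,j} ≥ 1 gives 0 ≥ 1. Each vertex thus turns length B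
-- into k·(4 + 4B) + 1 ≤ k⁵·B.

open import Defs
open import Data.Nat using (ℕ; _≤_; _*_; _+_; _^_)
open import Data.Fin using (Fin)
open import Data.List using (List)
open import Data.Product using (_×_; ∃-syntax)

open import Data.Nat using (zero; suc; s≤s; z≤n)
import Data.Nat.Properties as ℕ
open import Data.Integer as ℤ using (ℤ; +_; -_; -1ℤ)
import Data.Integer.Properties as ℤ
open import Data.Integer.Tactic.RingSolver using (solve-∀)
open import Data.Fin as F using ()
open import Data.Vec.Functional as Vector using (Vector)
open import Algebra.Properties.Monoid.Sum ℤ.+-0-monoid using (sum-syntax; sum-replicate-zero)
open import Data.List using ([]; _∷_; _++_; length)
import Data.List.Properties as List
open import Data.List.Relation.Unary.Any as Any using (Any; here; there)
open import Data.List.Membership.Propositional using (_∈_; find)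
open import Data.List.Membership.Propositional.Properties using (∈-++⁺ˡ; ∈-++⁺ʳ)
open import Data.Product using (_,_)
open import Data.Sum using (_⊎_; inj₁; inj₂)
open import Data.Bool using (Bool; true; false; if_then_else_; _∧_)
open import Relation.Nullary using (does)
open import Relation.Unary using (_⊆_)
open import Relation.Binary.PropositionalEquality using (_≡_; refl; sym; trans; cong; cong₂; subst; subst₂)

≐-refl : ∀ {n k} {I : Ineq n k} → I ≐ I
≐-refl = (λ _ _ → refl) , refl

≐-sym : ∀ {n k} {I J : Ineq n k} → I ≐ J → J ≐ I
≐-sym (c , d) = (λ w i → sym (c w i)) , sym d

≐-trans : ∀ {n k} {I J K : Ineq n k} → I ≐ J → J ≐ K → I ≐ K
≐-trans (c , d) (c′ , d′) = (λ w i → trans (c w i) (c′ w i)) , trans d d′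

addI-cong : ∀ {n k} {I I′ J J′ : Ineq n k} → I ≐ I′ → J ≐ J′ → addI I J ≐ addI I′ J′
addI-cong (c , d) (c′ , d′) = (λ w i → cong₂ ℤ._+_ (c w i) (c′ w i)) , cong₂ ℤ._+_ d d′

scaleI-cong : ∀ {n k} c {I I′ : Ineq n k} → I ≐ I′ → scaleI c I ≐ scaleI c I′
scaleI-cong c (p , q) = (λ w i → cong (+ c ℤ.*_) (p w i)) , cong (+ c ℤ.*_) q

-- RefutableWithin S L unfolds to DerivableWithin S falsum L.
DerivableWithin : ∀ {n k} → IneqSet n k → Ineq n k → ℕ → Set
DerivableWithin S I L =
  ∃[ ls ] (Derivation S ls × Any (_≐ I) ls × length ls ≤ L)

step-++ : ∀ {n k} {S : IneqSet n k} {ls I} ms → Step S ls I → Step S (ls ++ ms) I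
step-++ ms (ax-nonneg v j e)       = ax-nonneg v j e
step-++ ms (ax-le1 v j e)          = ax-le1 v j e
step-++ ms (hyp h)                 = hyp h
step-++ ms (sum J K p q e)         = sum J K (∈-++⁺ˡ p) (∈-++⁺ˡ q) e
step-++ ms (mult J c p e)          = mult J c (∈-++⁺ˡ p) e
step-++ ms (divide J c p c≥1 a b d) = divide J c (∈-++⁺ˡ p) c≥1 a b d

_++ᴰ_ : ∀ {n k} {S : IneqSet n k} {ls ms} → Derivation S ls → Derivation S ms → Derivation S (ls ++ ms)
[]         ++ᴰ e = e
(st ∷ d) ++ᴰ e = step-++ _ st ∷ (d ++ᴰ e)

derivation-⊆ : ∀ {n k} {S T : IneqSet n k} {ls} → S ⊆ T → Derivation S ls → Derivation T ls
derivation-⊆ S⊆T []                            = []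
derivation-⊆ S⊆T (ax-nonneg v j e ∷ d)        = ax-nonneg v j e ∷ derivation-⊆ S⊆T d
derivation-⊆ S⊆T (ax-le1 v j e ∷ d)           = ax-le1 v j e ∷ derivation-⊆ S⊆T d
derivation-⊆ S⊆T (hyp h ∷ d)                  = hyp (S⊆T h) ∷ derivation-⊆ S⊆T d
derivation-⊆ S⊆T (sum J K p q e ∷ d)          = sum J K p q e ∷ derivation-⊆ S⊆T d
derivation-⊆ S⊆T (mult J c p e ∷ d)           = mult J c p e ∷ derivation-⊆ S⊆T d
derivation-⊆ S⊆T (divide J c p c≥1 a b e ∷ d) = divide J c p c≥1 a b e ∷ derivation-⊆ S⊆T d

module _ {n k : ℕ} {S : IneqSet n k} where

  derivable-⊆ : ∀ {T I L} → S ⊆ T → DerivableWithin S I L → DerivableWithin T I L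
  derivable-⊆ S⊆T (ls , d , has , len) = ls , derivation-⊆ S⊆T d , has , len

  derivable-≤ : ∀ {I L L′} → L ≤ L′ → DerivableWithin S I L → DerivableWithin S I L′
  derivable-≤ L≤L′ (ls , d , has , len) = ls , d , has , ℕ.≤-trans len L≤L′

  derivable-≐ : ∀ {I I′ L} → I ≐ I′ → DerivableWithin S I L → DerivableWithin S I′ L
  derivable-≐ e (ls , d , has , len) = ls , d , Any.map (λ e′ → ≐-trans e′ e) has , len

  derivable-length≥1 : ∀ {I L} → DerivableWithin S I L → 1 ≤ L
  derivable-length≥1 (_ ∷ _ , _ , _ , len) = ℕ.≤-trans (s≤s z≤n) len

  derivable-hyp : ∀ {I} → S I → DerivableWithin S I 1
  derivable-hyp h = _ , hyp h ∷ [] , here ≐-refl , s≤s z≤n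

  derivable-addI : ∀ {I J M N} → DerivableWithin S I M → DerivableWithin S J N →
                   DerivableWithin S (addI I J) (suc (M + N))
  derivable-addI (ls , d , hasI , lenI) (ms , e , hasJ , lenJ)
    with find hasI | find hasJ
  ... | I′ , I′∈ls , I′≐I | J′ , J′∈ms , J′≐J =
    addI I′ J′ ∷ ls ++ ms
    , sum I′ J′ (∈-++⁺ˡ I′∈ls) (∈-++⁺ʳ ls J′∈ms) ≐-refl ∷ (d ++ᴰ e)
    , here (addI-cong I′≐I J′≐J)
    , s≤s (ℕ.≤-trans (ℕ.≤-reflexive (List.length-++ ls)) (ℕ.+-mono-≤ lenI lenJ))

sumI : ∀ {n k m} → Ineq n k → Vector (Ineq n k) m → Ineq n k
sumI {m = zero}  B Is = B
sumI {m = suc m} B Is = addI (Vector.head Is) (sumI B (Vector.tail Is))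

sumI-additive : ∀ {n k m} (f : Ineq n k → ℤ) → (∀ I J → f (addI I J) ≡ f I ℤ.+ f J) →
                ∀ B (Is : Vector (Ineq n k) m) → f (sumI B Is) ≡ ∑[ t < m ] f (Is t) ℤ.+ f B
sumI-additive {m = zero}  f f-add B Is = sym (ℤ.+-identityˡ (f B))
sumI-additive {m = suc m} f f-add B Is = begin
  f (addI (Is F.zero) (sumI B (Vector.tail Is)))
    ≡⟨ f-add _ _ ⟩
  f (Is F.zero) ℤ.+ f (sumI B (Vector.tail Is))
    ≡⟨ cong (ℤ._+_ (f (Is F.zero))) (sumI-additive f f-add B (Vector.tail Is)) ⟩
  f (Is F.zero) ℤ.+ (∑[ t < m ] f (Is (F.suc t)) ℤ.+ f B)
    ≡⟨ sym (ℤ.+-assoc (f (Is F.zero)) _ (f B)) ⟩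
  ∑[ t < suc m ] f (Is t) ℤ.+ f B ∎
  where open Relation.Binary.PropositionalEquality.≡-Reasoning

derivable-sumI : ∀ {n k m} {S : IneqSet n k} {B M N} {Is : Vector (Ineq n k) m} →
                 DerivableWithin S B M → (∀ t → DerivableWithin S (Is t) N) →
                 DerivableWithin S (sumI B Is) (m * suc N + M)
derivable-sumI {m = zero}  dB dIs = dB
derivable-sumI {m = suc m} {N = N} {Is = Is} dB dIs =
  derivable-≤ (ℕ.≤-reflexive (cong suc (sym (ℕ.+-assoc N (m * suc N) _))))
    (derivable-addI (dIs F.zero) (derivable-sumI {Is = Vector.tail Is} dB (λ t → dIs (F.suc t))))

∑-minus-indicator : ∀ {m} (i : Fin m) → ∑[ j < m ] (- (if does (i F.≟ j) then + 1 else + 0)) ≡ -1ℤ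
∑-minus-indicator {suc m} F.zero    = cong (ℤ._+_ -1ℤ) (sum-replicate-zero m)
∑-minus-indicator {suc m} (F.suc i) = trans (ℤ.+-identityˡ _) (∑-minus-indicator i)

∑-minus-units : ∀ {m} (b : Bool) (i : Fin m) →
                ∑[ j < m ] (- (if b ∧ does (i F.≟ j) then + 1 else + 0)) ℤ.+ (if b then + 1 else + 0) ≡ + 0
∑-minus-units     true  i = cong (ℤ._+ + 1) (∑-minus-indicator i)
∑-minus-units {m} false i = cong (ℤ._+ + 0) (sum-replicate-zero m)

row-minus-units≐falsum : ∀ {n k} (v : Fin n) → sumI (geI (row v) (+ 1)) (λ j → leI {n} {k} (unit v j) (+ 0)) ≐ falsum
row-minus-units≐falsum {n} {k} v =
  (λ w i → trans (sumI-additive (λ I → coeff I w i) (λ _ _ → refl) rowv units) (∑-minus-units (does (w F.≟ v)) i))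
  , trans (sumI-additive const (λ _ _ → refl) rowv units) (cong (ℤ._+ + 1) (sum-replicate-zero k))
  where
  rowv : Ineq n k
  rowv = geI (row v) (+ 1)
  units : Vector (Ineq n k) k
  units j = leI (unit v j) (+ 0)

refute-by-excluding-colours : ∀ {n k} {Γ : IneqSet n k} {v N} → Γ (geI (row v) (+ 1)) →
                              (∀ j → DerivableWithin Γ (leI (unit v j) (+ 0)) N) →
                              RefutableWithin Γ (k * suc N + 1)
refute-by-excluding-colours {v = v} rowv excluded =
  derivable-≐ (row-minus-units≐falsum v) (derivable-sumI (derivable-hyp rowv) excluded)

-- Binds tighter than _≐_, which has the default fixity 20.
infixl 25 _−_·_

_−_·_ : ∀ {n k} → Ineq n k → ℕ → Ineq n k → Ineq n k
I − M · A = mkIneq (λ w i → coeff I w i ℤ.- + M ℤ.* coeff A w i) (const I ℤ.- + M ℤ.* const A)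

reverseI : ∀ {n k} → Ineq n k → Ineq n k
reverseI A = leI (coeff A) (const A)

EqualityIneqs : ∀ {n k} → Ineq n k → IneqSet n k
EqualityIneqs A I = I ≐ reverseI A ⊎ I ≐ A

module −·-Properties {n k : ℕ} (A : Ineq n k) where

  −·-cong : ∀ M {I J} → I ≐ J → I − M · A ≐ J − M · A
  −·-cong M (c , d) =
    (λ w i → cong (ℤ._- + M ℤ.* coeff A w i) (c w i)) , cong (ℤ._- + M ℤ.* const A) d

  −·-zero : ∀ I → I − 0 · A ≐ I
  −·-zero I = (λ w i → ℤ.+-identityʳ (coeff I w i)) , ℤ.+-identityʳ (const I)

  −·-self : ∀ B → A − 1 · A ≐ scaleI 0 B
  −·-self B = (λ w i → law (coeff A w i)) , law (const A)
    where
    law : ∀ a → a ℤ.- + 1 ℤ.* a ≡ + 0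
    law = solve-∀

  −·-addI : ∀ I J M N → addI (I − M · A) (J − N · A) ≐ addI I J − (M + N) · A
  −·-addI I J M N =
    (λ w i → law (coeff I w i) (coeff J w i) (coeff A w i)) , law (const I) (const J) (const A)
    where
    ring : ∀ a b m n x → (a ℤ.- m ℤ.* x) ℤ.+ (b ℤ.- n ℤ.* x) ≡ (a ℤ.+ b) ℤ.- (m ℤ.+ n) ℤ.* x
    ring = solve-∀
    law : ∀ a b x → (a ℤ.- + M ℤ.* x) ℤ.+ (b ℤ.- + N ℤ.* x) ≡ (a ℤ.+ b) ℤ.- + (M + N) ℤ.* x
    law a b x = trans (ring a b (+ M) (+ N) x) (cong (λ m → (a ℤ.+ b) ℤ.- m ℤ.* x) (sym (ℤ.pos-+ M N)))

  −·-scaleI : ∀ c I M → scaleI c (I − M · A) ≐ scaleI c I − (c * M) · A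
  −·-scaleI c I M = (λ w i → law (coeff I w i) (coeff A w i)) , law (const I) (const A)
    where
    ring : ∀ c a m x → c ℤ.* (a ℤ.- m ℤ.* x) ≡ c ℤ.* a ℤ.- (c ℤ.* m) ℤ.* x
    ring = solve-∀
    law : ∀ a x → + c ℤ.* (a ℤ.- + M ℤ.* x) ≡ + c ℤ.* a ℤ.- + (c * M) ℤ.* x
    law a x = trans (ring (+ c) a (+ M) x) (cong (λ m → + c ℤ.* a ℤ.- m ℤ.* x) (sym (ℤ.pos-* c M)))

record Division {n k} (c : ℕ) (J I : Ineq n k) : Set where
  field
    coeff-≡ : ∀ w i → coeff J w i ≡ + c ℤ.* coeff I w i
    const-≤ : const J ℤ.≤ + c ℤ.* const I
    const-< : + c ℤ.* const I ℤ.< const J ℤ.+ + c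

divide-by : ∀ {n k} {S : IneqSet n k} {prev J I} c → J ∈ prev → Division (suc c) J I → Step S prev I
divide-by {J = J} c J∈prev d = divide J (suc c) J∈prev (s≤s z≤n) coeff-≡ const-≤ const-<
  where open Division d

-- Adding c·M copies of −A to J − M·A gives J − (c + 1)·M·A, whose division by c + 1 is I − M·A.
division-−· : ∀ {n k} {c M} {A J J′ I : Ineq n k} → Division (suc c) J I → J′ ≐ J − M · A →
              Division (suc c) (addI J′ (scaleI (c * M) (reverseI A))) (I − M · A)
division-−· {c = c} {M} {A} {J} {J′} {I} d (J′≐ , γ′≐) = record
  { coeff-≡ = λ w i → trans (collect (coeff J w i) (J′≐ w i))
                        (trans (cong (ℤ._- X (coeff A w i)) (coeff-≡ w i))
                               (sym (distrib (coeff I w i) (coeff A w i))))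
  ; const-≤ = subst₂ ℤ._≤_ (sym (collect (const J) γ′≐)) (sym (distrib (const I) (const A)))
                (ℤ.+-monoˡ-≤ (- X (const A)) const-≤)
  ; const-< = subst₂ ℤ._<_ (sym (distrib (const I) (const A)))
                (trans (swap (const J) (X (const A)) (+ suc c)) (cong (ℤ._+ + suc c) (sym (collect (const J) γ′≐))))
                (ℤ.+-monoˡ-< (- X (const A)) const-<)
  }
  where
  open Division d
  X : ℤ → ℤ
  X a = + suc c ℤ.* + M ℤ.* a
  collect-law : ∀ γ c m a → (γ ℤ.- m ℤ.* a) ℤ.+ (c ℤ.* m) ℤ.* - a ≡ γ ℤ.- (+ 1 ℤ.+ c) ℤ.* m ℤ.* a
  collect-law = solve-∀
  collect : ∀ y {x a} → x ≡ y ℤ.- + M ℤ.* a → x ℤ.+ + (c * M) ℤ.* - a ≡ y ℤ.- X a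
  collect y {x} {a} x≡ =
    trans (cong₂ (λ x m → x ℤ.+ m ℤ.* - a) x≡ (ℤ.pos-* c M)) (collect-law y (+ c) (+ M) a)
  distrib-law : ∀ c γ m a → (+ 1 ℤ.+ c) ℤ.* (γ ℤ.- m ℤ.* a) ≡ (+ 1 ℤ.+ c) ℤ.* γ ℤ.- (+ 1 ℤ.+ c) ℤ.* m ℤ.* a
  distrib-law = solve-∀
  distrib : ∀ γ a → + suc c ℤ.* (γ ℤ.- + M ℤ.* a) ≡ + suc c ℤ.* γ ℤ.- X a
  distrib γ a = distrib-law (+ c) γ (+ M) a
  swap : ∀ a x y → (a ℤ.+ y) ℤ.+ - x ≡ (a ℤ.- x) ℤ.+ y
  swap = solve-∀

-- Adding −A to falsum − M·A gives −(M + 1)·A ≥ 1 − (M + 1)·a; division by M + 1 rounds the constant up to 1 − a.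
division-falsum : ∀ {n k} {M} {A F′ : Ineq n k} → F′ ≐ falsum − M · A →
                  Division (suc M) (addI F′ (reverseI A)) (leI (coeff A) (const A ℤ.- + 1))
division-falsum {M = M} {A} {F′} (F′≐ , γ′≐) = record
  { coeff-≡ = λ w i → trans (cong (ℤ._+ - coeff A w i) (F′≐ w i)) (coeff-law (+ M) (coeff A w i))
  ; const-≤ = subst (e ℤ.≤_) (sym scaled) (ℤ.i≤i+j e (+ M))
  ; const-< = subst (ℤ._< e ℤ.+ + suc M) (sym scaled) (ℤ.+-monoʳ-< e (ℤ.+<+ (ℕ.n<1+n M)))
  }
  where
  α e : ℤ
  α = const A
  e = const F′ ℤ.+ - α
  coeff-law : ∀ m a → (+ 0 ℤ.- m ℤ.* a) ℤ.+ - a ≡ (+ 1 ℤ.+ m) ℤ.* - a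
  coeff-law = solve-∀
  const-law : ∀ m a → (+ 1 ℤ.+ m) ℤ.* - (a ℤ.- + 1) ≡ ((+ 1 ℤ.- m ℤ.* a) ℤ.+ - a) ℤ.+ m
  const-law = solve-∀
  scaled : + suc M ℤ.* - (α ℤ.- + 1) ≡ e ℤ.+ + M
  scaled = trans (const-law (+ M) α) (cong (λ γ → (γ ℤ.+ - α) ℤ.+ + M) (sym γ′≐))

module Deduction {n k : ℕ} (Γ : IneqSet n k) (A : Ineq n k) (reverse-A : ∀ {prev} → Step Γ prev (reverseI A)) where

  open −·-Properties A

  ShiftedIn : List (Ineq n k) → Ineq n k → Set
  ShiftedIn ls I = ∃[ M ] ∃[ I′ ] (I′ ∈ ls × I′ ≐ I − M · A)

  record Translation (ls : List (Ineq n k)) : Set where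
    field
      lines      : List (Ineq n k)
      derivation : Derivation Γ lines
      shifted    : ∀ {I} → I ∈ ls → ShiftedIn lines I
      length≤    : length lines ≤ 4 * length ls
  open Translation

  record Extension {ls} (T : Translation ls) (I : Ineq n k) : Set where
    field
      new         : List (Ineq n k)
      extended    : Derivation Γ (new ++ lines T)
      new-shifted : ShiftedIn new I
      new≤4       : length new ≤ 4

  extend : ∀ {ls I} {T : Translation ls} → Extension T I → Translation (I ∷ ls)
  extend {ls} {I} {T} E = record
    { lines      = new ++ lines T
    ; derivation = extended
    ; shifted    = shifted′
    ; length≤    = ℕ.≤-trans (ℕ.≤-reflexive (List.length-++ new))
                     (ℕ.≤-trans (ℕ.+-mono-≤ new≤4 (length≤ T)) (ℕ.≤-reflexive (sym (ℕ.*-suc 4 (length ls)))))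
    }
    where
    open Extension E
    shifted′ : ∀ {J} → J ∈ I ∷ ls → ShiftedIn (new ++ lines T) J
    shifted′ (here refl) with new-shifted
    ... | M , I′ , I′∈new , I′≐ = M , I′ , ∈-++⁺ˡ I′∈new , I′≐
    shifted′ (there J∈ls) with shifted T J∈ls
    ... | M , J′ , J′∈lines , J′≐ = M , J′ , ∈-++⁺ʳ new J′∈lines , J′≐

  one-line : ∀ {ls I I′} (T : Translation ls) M → Step Γ (lines T) I′ → I′ ≐ I − M · A → Extension T I
  one-line T M st I′≐ = record
    { new = _ ∷ [] ; extended = st ∷ derivation T ; new-shifted = M , _ , here refl , I′≐ ; new≤4 = s≤s z≤n }

  unchanged : ∀ {ls I} (T : Translation ls) → Step Γ (lines T) I → Extension T I
  unchanged {I = I} T st = one-line T 0 st (≐-sym (−·-zero I))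

  extension : ∀ {ls I} → Step (Γ ∪ EqualityIneqs A) ls I → (T : Translation ls) → Extension T I
  extension (ax-nonneg w i e)     T = unchanged T (ax-nonneg w i e)
  extension (ax-le1 w i e)        T = unchanged T (ax-le1 w i e)
  extension (hyp (inj₁ g))        T = unchanged T (hyp g)
  extension {I = I} (hyp (inj₂ (inj₁ I≐))) T = one-line T 0 reverse-A (≐-sym (≐-trans (−·-zero I) I≐))
  extension {I = I} (hyp (inj₂ (inj₂ I≐))) T = record
    { new         = scaleI 0 (reverseI A) ∷ reverseI A ∷ []
    ; extended    = mult (reverseI A) 0 (here refl) ≐-refl ∷ reverse-A ∷ derivation T
    ; new-shifted = 1 , _ , here refl , ≐-sym (≐-trans (−·-cong 1 I≐) (−·-self (reverseI A)))
    ; new≤4       = s≤s (s≤s z≤n)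
    }
  extension (sum J K J∈ K∈ I≐) T with shifted T J∈ | shifted T K∈
  ... | M , J′ , J′∈ , J′≐ | N , K′ , K′∈ , K′≐ =
    one-line T (M + N) (sum J′ K′ J′∈ K′∈ ≐-refl)
      (≐-trans (addI-cong J′≐ K′≐) (≐-trans (−·-addI J K M N) (−·-cong (M + N) (≐-sym I≐))))
  extension (mult J c J∈ I≐) T with shifted T J∈
  ... | M , J′ , J′∈ , J′≐ =
    one-line T (c * M) (mult J′ c J′∈ ≐-refl)
      (≐-trans (scaleI-cong c J′≐) (≐-trans (−·-scaleI c J M) (−·-cong (c * M) (≐-sym I≐))))
  extension (divide J zero _ () _ _ _) T
  extension {I = I} (divide J (suc c) J∈ _ hc hlo hhi) T with shifted T J∈
  ... | M , J′ , J′∈ , J′≐ = record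
    { new         = I − M · A ∷ addI J′ scaled-reverse-A ∷ scaled-reverse-A ∷ reverseI A ∷ []
    ; extended    = divide-by c (here refl) (division-−· (record { coeff-≡ = hc ; const-≤ = hlo ; const-< = hhi }) J′≐)
                    ∷ sum J′ scaled-reverse-A (there (there J′∈)) (here refl) ≐-refl
                    ∷ mult (reverseI A) (c * M) (here refl) ≐-refl
                    ∷ reverse-A
                    ∷ derivation T
    ; new-shifted = M , _ , here refl , ≐-refl
    ; new≤4       = ℕ.≤-refl
    }
    where
    scaled-reverse-A : Ineq n k
    scaled-reverse-A = scaleI (c * M) (reverseI A)

  translate : ∀ {ls} → Derivation (Γ ∪ EqualityIneqs A) ls → Translation ls
  translate []       = record { lines = [] ; derivation = [] ; shifted = λ () ; length≤ = z≤n }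
  translate (st ∷ d) = extend (extension st (translate d))

  deduction : ∀ {L} → RefutableWithin (Γ ∪ EqualityIneqs A) L →
              DerivableWithin Γ (leI (coeff A) (const A ℤ.- + 1)) (3 + 4 * L)
  deduction (ls , d , has-falsum , len) with find has-falsum
  ... | F , F∈ , F≐ with shifted (translate d) F∈
  ... | M , F′ , F′∈ , F′≐ =
    _ ∷ addI F′ (reverseI A) ∷ reverseI A ∷ lines T
    , divide-by M (here refl) (division-falsum (≐-trans F′≐ (−·-cong M F≐)))
      ∷ sum F′ (reverseI A) (there F′∈) (here refl) ≐-refl
      ∷ reverse-A
      ∷ derivation T
    , here ≐-refl
    , s≤s (s≤s (s≤s (ℕ.≤-trans (length≤ T) (ℕ.*-monoʳ-≤ 4 len))))
    where
    T : Translation ls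
    T = translate d

nine≤^4 : ∀ {k} → 2 ≤ k → 9 ≤ k ^ 4
nine≤^4 2≤k = ℕ.≤-trans (ℕ.m≤m+n 9 7) (ℕ.^-monoˡ-≤ 4 2≤k)

colour-step-bound : ∀ {k B} → 2 ≤ k → 1 ≤ B → k * suc (3 + 4 * B) + 1 ≤ k ^ 5 * B
colour-step-bound {k} {B} 2≤k 1≤B = begin
  k * suc (3 + 4 * B) + 1   ≤⟨ ℕ.+-monoʳ-≤ (k * suc (3 + 4 * B)) (ℕ.≤-trans (s≤s z≤n) 2≤k) ⟩
  k * suc (3 + 4 * B) + k   ≡⟨ ℕ.+-comm (k * suc (3 + 4 * B)) k ⟩
  k + k * suc (3 + 4 * B)   ≡⟨ ℕ.*-suc k (suc (3 + 4 * B)) ⟨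
  k * (5 + 4 * B)           ≤⟨ ℕ.*-monoʳ-≤ k (ℕ.+-monoˡ-≤ (4 * B) (ℕ.*-monoʳ-≤ 5 1≤B)) ⟩
  k * (5 * B + 4 * B)       ≡⟨ cong (k *_) (ℕ.*-distribʳ-+ B 5 4) ⟨
  k * (9 * B)               ≤⟨ ℕ.*-monoʳ-≤ k (ℕ.*-monoˡ-≤ B (nine≤^4 2≤k)) ⟩
  k * (k ^ 4 * B)           ≡⟨ ℕ.*-assoc k (k ^ 4) B ⟨
  k ^ 5 * B                 ∎
  where open ℕ.≤-Reasoning

k^5*k^5ℓ≡k^5[1+ℓ] : ∀ k ℓ L → k ^ 5 * (k ^ (5 * ℓ) * L) ≡ k ^ (5 * suc ℓ) * L
k^5*k^5ℓ≡k^5[1+ℓ] k ℓ L = begin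
  k ^ 5 * (k ^ (5 * ℓ) * L)  ≡⟨ ℕ.*-assoc (k ^ 5) (k ^ (5 * ℓ)) L ⟨
  k ^ 5 * k ^ (5 * ℓ) * L    ≡⟨ cong (_* L) (ℕ.^-distribˡ-+-* k 5 (5 * ℓ)) ⟨
  k ^ (5 + 5 * ℓ) * L        ≡⟨ cong (λ e → k ^ e * L) (ℕ.*-suc 5 ℓ) ⟨
  k ^ (5 * suc ℓ) * L        ∎
  where open Relation.Binary.PropositionalEquality.≡-Reasoning

k^5ℓ≤k^5[ℓ+1] : ∀ {k} → 2 ≤ k → ∀ ℓ L → k ^ (5 * ℓ) * L ≤ k ^ (5 * (ℓ + 1)) * L
k^5ℓ≤k^5[ℓ+1] (s≤s (s≤s _)) ℓ L = ℕ.*-monoˡ-≤ L (ℕ.^-monoʳ-≤ _ (ℕ.*-monoʳ-≤ 5 (ℕ.m≤m+n ℓ 1)))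

refutable-by-colour-cases : ∀ {n k} → 2 ≤ k → (Γ : IneqSet n k) → (∀ v → Γ (geI (row v) (+ 1))) →
                            ∀ ℓ (u : Fin ℓ → Fin n) L →
                            (∀ c → RefutableWithin (Γ ∪ FixColours u c) L) →
                            RefutableWithin Γ (k ^ (5 * ℓ) * L)
refutable-by-colour-cases 2≤k Γ rows zero u L refuted =
  derivable-≤ (ℕ.≤-reflexive (sym (ℕ.*-identityˡ L))) (derivable-⊆ nothing-fixed (refuted (λ ())))
  where
  nothing-fixed : Γ ∪ FixColours u (λ ()) ⊆ Γ
  nothing-fixed (inj₁ g)       = g
  nothing-fixed (inj₂ (() , _))
refutable-by-colour-cases {n} {k} 2≤k@(s≤s (s≤s _)) Γ rows (suc ℓ) u L refuted =
  derivable-≤ bound (refute-by-excluding-colours (rows v) excluded)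
  where
  v : Fin n
  v = Vector.head u
  B : ℕ
  B = k ^ (5 * ℓ) * L
  split : ∀ j c → Γ ∪ FixColours u (j Vector.∷ c) ⊆ (Γ ∪ EqualityIneqs (geI (unit v j) (+ 1))) ∪ FixColours (Vector.tail u) c
  split j c (inj₁ g)              = inj₁ (inj₁ g)
  split j c (inj₂ (F.zero , e))   = inj₁ (inj₂ e)
  split j c (inj₂ (F.suc i , e))  = inj₂ (i , e)
  refuted-with : ∀ j → RefutableWithin (Γ ∪ EqualityIneqs (geI (unit v j) (+ 1))) B
  refuted-with j = refutable-by-colour-cases 2≤k _ (λ w → inj₁ (rows w)) ℓ (Vector.tail u) L
                     (λ c → derivable-⊆ (split j c) (refuted (j Vector.∷ c)))
  excluded : ∀ j → DerivableWithin Γ (leI (unit v j) (+ 0)) (3 + 4 * B)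
  excluded j = Deduction.deduction Γ (geI (unit v j) (+ 1)) (ax-le1 v j ≐-refl) (refuted-with j)
  bound : k * suc (3 + 4 * B) + 1 ≤ k ^ (5 * suc ℓ) * L
  bound = ℕ.≤-trans (colour-step-bound 2≤k (derivable-length≥1 (refuted-with F.zero)))
                    (ℕ.≤-reflexive (k^5*k^5ℓ≡k^5[1+ℓ] k ℓ L))

proposition4p2 : ∃[ C ] ((n k : ℕ) (E : List (Fin n × Fin n)) → 2 ≤ k →
                   (ℓ : ℕ) (u : Fin ℓ → Fin n) (L : ℕ) →
                   ((c : Fin ℓ → Fin k) → RefutableWithin (ColouringIneqs n k E ∪ FixColours u c) L) →
                   RefutableWithin (ColouringIneqs n k E) (k ^ (C * (ℓ + 1)) * L))
proposition4p2 = 5 , λ n k E 2≤k ℓ u L refuted →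
  derivable-≤ (k^5ℓ≤k^5[ℓ+1] 2≤k ℓ L)
    (refutable-by-colour-cases 2≤k (ColouringIneqs n k E) (λ v → inj₁ (v , ≐-refl)) ℓ u L refuted)
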